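{- For $m\in\mathbb{Z}$ and $n\in\mathbb{Q}$, let \[R_{m,n}(X)=m(X^2+9X-3m)^3-n(X^3-2mX^2-9mX-2m^2-27m)^2.\] (i) For $m\in\mathbb{Z}\setminus\{0\}$, there exists $u\in\mathbb{Q}$ with $R_{m,0}(u)=0$ if and only if there exists $c\in\mathbb{Z}$ with $m=3c(c+3)$. (ii) For $m\in\mathbb{Z}\setminus\{0\}$, there exists $u\in\mathbb{Q}$ with $R_{m,-27/4}(u)=0$ if and only if $m=-8$. -}

module Defs where

open import Data.Integer as ℤ using (ℤ)
open import Data.Rational using (ℚ; _+_; _*_; _-_; -_; _/_; 0ℚ)

R : ℤ → ℚ → ℚ → ℚ
R m n X = (M * (A * A * A)) - (n * (B * B))
  where
  M : ℚ
  M = m / 1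
  A : ℚ
  A = (X * X) + ((9ℤ / 1) * X) - ((ℤ.+ 3 / 1) * M)
    where
    9ℤ : ℤ
    9ℤ = ℤ.+ 9
  B : ℚ
  B = (X * X * X) - ((ℤ.+ 2 / 1) * M * X * X) - ((ℤ.+ 9 / 1) * M * X)
      - ((ℤ.+ 2 / 1) * M * M) - ((ℤ.+ 27 / 1) * M)

{-# OPTIONS --safe #-}
module Submission where

-- With A = X² + 9X - 3m, B the second factor of R, and C = X³ + 9mX + 27m, we have
-- R m 0 = m A³ and 4 R m n = (4m + 27) C² - (4n + 27) B², so at n = -27/4 the roots of R
-- are those of C, as 4m + 27 ≠ 0. Both A and C are monic with integer coefficients, so a
-- rational root p / q in lowest terms has q ∣ p^k, hence q = 1. Reducing mod 3 gives 3 ∣ p.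
-- For A, p = 3c turns A = 0 into m = 3c(c + 3). For C, p = 3y turns C = 0 into
-- y³ + my + m = 0, i.e. (y + 1)(y² - y + 1 + m) = 1, so y = 0 (then m = 0) or y = -2, m = -8.

open import Defs
open import Data.Integer using (ℤ; +_; -[1+_]; 0ℤ; 1ℤ; -1ℤ; _+_; _*_; _-_; -_; _^_; ∣_∣)
import Data.Integer.Properties as ℤ
open import Data.Integer.Divisibility.Signed as ℤ∣ using (∣ᵤ⇒∣)
open import Data.Integer.Tactic.RingSolver using (solve-∀)
open import Data.Nat as ℕ using (zero; suc; nonTrivial⇒≢1)
import Data.Nat.Properties as ℕ
open import Data.Nat.Coprimality as Coprime using (Coprime; coprime-divisor)
open import Data.Nat.Divisibility using (_∣_; _∣?_; divides; ∣1⇒≡1)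
open import Data.Nat.Primality using (Prime; prime?; euclidsLemma; prime⇒nonTrivial)
open import Data.Product using (∃; _×_; _,_)
open import Data.Rational as ℚ using (ℚ; mkℚ; ↥_; ↧_; 0ℚ; toℚᵘ; fromℚᵘ)
open import Data.Rational.Properties
  using (toℚᵘ-injective; toℚᵘ-homo-+; toℚᵘ-homo-*; toℚᵘ-homo‿-; toℚᵘ-fromℚᵘ;
         fromℚᵘ-injective; fromℚᵘ-cong; fromℚᵘ-toℚᵘ; ↥p≡0⇒p≡0; p≡0⇒↥p≡0; ↥-*; *-identityˡ; *-zeroʳ)
open import Data.Rational.Solver using (module +-*-Solver)
open import Data.Rational.Unnormalised as ℚᵘ using (mkℚᵘ; *≡*)
import Data.Rational.Unnormalised.Properties as ℚᵘ
open import Data.Sum using (_⊎_; inj₁; inj₂; [_,_]′; map)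
open import Function using (id)
open import Function.Bundles using (_⇔_; mk⇔)
open import Relation.Binary.PropositionalEquality
open import Relation.Nullary using (contradiction)
open import Relation.Nullary.Decidable using (from-yes; from-no)

open +-*-Solver

coprime∧∣^⇒≡1 : ∀ {a b} k → Coprime a b → b ∣ a ℕ.^ k → b ≡ 1
coprime∧∣^⇒≡1 zero    _   b∣1       = ∣1⇒≡1 b∣1
coprime∧∣^⇒≡1 (suc k) a⊥b b∣a*a^k = coprime∧∣^⇒≡1 k a⊥b (coprime-divisor (Coprime.sym a⊥b) b∣a*a^k)

prime∣^⇒∣ : ∀ {p a} k → Prime p → p ∣ a ℕ.^ k → p ∣ a
prime∣^⇒∣         zero    pr p∣1     = contradiction (∣1⇒≡1 p∣1) (nonTrivial⇒≢1 {{prime⇒nonTrivial pr}})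
prime∣^⇒∣ {a = a} (suc k) pr p∣a*a^k = [ id , prime∣^⇒∣ k pr ]′ (euclidsLemma a (a ℕ.^ k) pr p∣a*a^k)

prime[3] : Prime 3
prime[3] = from-yes (prime? 3)

abs-^ : ∀ i k → ∣ i ^ k ∣ ≡ ∣ i ∣ ℕ.^ k
abs-^ i zero    = refl
abs-^ i (suc k) = trans (ℤ.abs-* i (i ^ k)) (cong (∣ i ∣ ℕ.*_) (abs-^ i k))

i^k≡t*p⇒p∣i : ∀ {p} i k t → Prime p → i ^ k ≡ t * + p → + p ℤ∣.∣ i
i^k≡t*p⇒p∣i {p} i k t pr eq = ∣ᵤ⇒∣ (prime∣^⇒∣ k pr (divides ∣ t ∣ ∣i∣^k≡∣t∣*p))
  where
  ∣i∣^k≡∣t∣*p : ∣ i ∣ ℕ.^ k ≡ ∣ t ∣ ℕ.* p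
  ∣i∣^k≡∣t∣*p = trans (sym (abs-^ i k)) (trans (cong ∣_∣ eq) (ℤ.abs-* t (+ p)))

i*j≡1⇒i≡±1 : ∀ i j → i * j ≡ 1ℤ → i ≡ 1ℤ ⊎ i ≡ -1ℤ
i*j≡1⇒i≡±1 i j eq with ℕ.m*n≡1⇒m≡1 ∣ i ∣ ∣ j ∣ (trans (sym (ℤ.abs-* i j)) (cong ∣_∣ eq))
i*j≡1⇒i≡±1 (+ .1)    _ _ | refl = inj₁ refl
i*j≡1⇒i≡±1 -[1+ .0 ] _ _ | refl = inj₂ refl

-- The ring solver cannot use hypotheses: to use a ≡ b, prove x ≡ y + c * (a - b) with it instead.
x≡y+c*[a-b]∧a≡b⇒x≡y : ∀ {x y a b} c → x ≡ y + c * (a - b) → a ≡ b → x ≡ y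
x≡y+c*[a-b]∧a≡b⇒x≡y {x} {y} {b = b} c x≡y+c*[a-b] refl = begin
  x                  ≡⟨ x≡y+c*[a-b] ⟩
  y + c * (b - b)    ≡⟨ cong (λ z → y + c * z) (ℤ.+-inverseʳ b) ⟩
  y + c * 0ℤ         ≡⟨ cong (_+_ y) (ℤ.*-zeroʳ c) ⟩
  y + 0ℤ             ≡⟨ ℤ.+-identityʳ y ⟩
  y                  ∎
  where open ≡-Reasoning

4*m+27≢0 : ∀ m → + 4 * m + + 27 ≢ 0ℤ
4*m+27≢0 m 4m+27≡0 = from-no (4 ∣? 27) (divides ∣ - m ∣ 27≡∣-m∣*4)
  where
  27≡4*[-m]+[4m+27] : ∀ m → + 27 ≡ + 4 * - m + 1ℤ * ((+ 4 * m + + 27) - 0ℤ)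
  27≡4*[-m]+[4m+27] = solve-∀
  27≡∣-m∣*4 : 27 ≡ ∣ - m ∣ ℕ.* 4
  27≡∣-m∣*4 = trans (cong ∣_∣ (x≡y+c*[a-b]∧a≡b⇒x≡y {y = + 4 * - m} 1ℤ (27≡4*[-m]+[4m+27] m) 4m+27≡0))
                    (trans (ℤ.abs-* (+ 4) (- m)) (ℕ.*-comm 4 ∣ - m ∣))

-- The embedding used in Defs; ι i is definitionally fromℚᵘ (mkℚᵘ i 0).
ι : ℤ → ℚ
ι i = i ℚ./ 1

fromℚᵘ-homo-+ : ∀ p q → fromℚᵘ (p ℚᵘ.+ q) ≡ fromℚᵘ p ℚ.+ fromℚᵘ q
fromℚᵘ-homo-+ p q = toℚᵘ-injective (begin
  toℚᵘ (fromℚᵘ (p ℚᵘ.+ q))                ≈⟨ toℚᵘ-fromℚᵘ (p ℚᵘ.+ q) ⟩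
  p ℚᵘ.+ q                                 ≈⟨ ℚᵘ.+-cong (toℚᵘ-fromℚᵘ p) (toℚᵘ-fromℚᵘ q) ⟨
  toℚᵘ (fromℚᵘ p) ℚᵘ.+ toℚᵘ (fromℚᵘ q)    ≈⟨ toℚᵘ-homo-+ (fromℚᵘ p) (fromℚᵘ q) ⟨
  toℚᵘ (fromℚᵘ p ℚ.+ fromℚᵘ q)            ∎)
  where open ℚᵘ.≃-Reasoning

fromℚᵘ-homo-* : ∀ p q → fromℚᵘ (p ℚᵘ.* q) ≡ fromℚᵘ p ℚ.* fromℚᵘ q
fromℚᵘ-homo-* p q = toℚᵘ-injective (begin
  toℚᵘ (fromℚᵘ (p ℚᵘ.* q))                ≈⟨ toℚᵘ-fromℚᵘ (p ℚᵘ.* q) ⟩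
  p ℚᵘ.* q                                 ≈⟨ ℚᵘ.*-cong (toℚᵘ-fromℚᵘ p) (toℚᵘ-fromℚᵘ q) ⟨
  toℚᵘ (fromℚᵘ p) ℚᵘ.* toℚᵘ (fromℚᵘ q)    ≈⟨ toℚᵘ-homo-* (fromℚᵘ p) (fromℚᵘ q) ⟨
  toℚᵘ (fromℚᵘ p ℚ.* fromℚᵘ q)            ∎)
  where open ℚᵘ.≃-Reasoning

fromℚᵘ-homo‿- : ∀ p → fromℚᵘ (ℚᵘ.- p) ≡ ℚ.- fromℚᵘ p
fromℚᵘ-homo‿- p = toℚᵘ-injective (begin
  toℚᵘ (fromℚᵘ (ℚᵘ.- p))   ≈⟨ toℚᵘ-fromℚᵘ (ℚᵘ.- p) ⟩
  ℚᵘ.- p                    ≈⟨ ℚᵘ.-‿cong (toℚᵘ-fromℚᵘ p) ⟨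
  ℚᵘ.- toℚᵘ (fromℚᵘ p)     ≈⟨ toℚᵘ-homo‿- (fromℚᵘ p) ⟨
  toℚᵘ (ℚ.- fromℚᵘ p)      ∎)
  where open ℚᵘ.≃-Reasoning

ι-+ : ∀ i j → ι (i + j) ≡ ι i ℚ.+ ι j
ι-+ i j = trans (fromℚᵘ-cong {mkℚᵘ (i + j) 0} {mkℚᵘ i 0 ℚᵘ.+ mkℚᵘ j 0} (*≡* (i+j≡i*1+j*1 i j)))
                (fromℚᵘ-homo-+ (mkℚᵘ i 0) (mkℚᵘ j 0))
  where
  i+j≡i*1+j*1 : ∀ i j → (i + j) * 1ℤ ≡ (i * 1ℤ + j * 1ℤ) * 1ℤ
  i+j≡i*1+j*1 = solve-∀

ι-* : ∀ i j → ι (i * j) ≡ ι i ℚ.* ι j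
ι-* i j = fromℚᵘ-homo-* (mkℚᵘ i 0) (mkℚᵘ j 0)

ι-- : ∀ i j → ι (i - j) ≡ ι i ℚ.- ι j
ι-- i j = trans (ι-+ i (- j)) (cong (ι i ℚ.+_) (fromℚᵘ-homo‿- (mkℚᵘ j 0)))

ι-*-* : ∀ i j k → ι (i * j * k) ≡ ι i ℚ.* ι j ℚ.* ι k
ι-*-* i j k = trans (ι-* (i * j) k) (cong (ℚ._* ι k) (ι-* i j))

ι-injective : ∀ {i j} → ι i ≡ ι j → i ≡ j
ι-injective {i} {j} ιi≡ιj with fromℚᵘ-injective {mkℚᵘ i 0} {mkℚᵘ j 0} ιi≡ιj
... | *≡* i*1≡j*1 = trans (sym (ℤ.*-identityʳ i)) (trans i*1≡j*1 (ℤ.*-identityʳ j))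

↧*≡↥ : ∀ u → ι (↧ u) ℚ.* u ≡ ι (↥ u)
↧*≡↥ u@(mkℚ p d _) = begin
  ι (+ suc d) ℚ.* u                                   ≡⟨ cong (ι (+ suc d) ℚ.*_) (fromℚᵘ-toℚᵘ u) ⟨
  ι (+ suc d) ℚ.* fromℚᵘ (mkℚᵘ p d)                   ≡⟨ fromℚᵘ-homo-* (mkℚᵘ (+ suc d) 0) (mkℚᵘ p d) ⟨
  fromℚᵘ (mkℚᵘ (+ suc d) 0 ℚᵘ.* mkℚᵘ p d)
    ≡⟨ fromℚᵘ-cong {mkℚᵘ (+ suc d) 0 ℚᵘ.* mkℚᵘ p d} {mkℚᵘ p 0} (*≡* [1+d]*p*1≡p*[1+d]) ⟩
  ι p                                                 ∎
  where
  open ≡-Reasoning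
  [1+d]*p*1≡p*[1+d] : (+ suc d * p) * 1ℤ ≡ p * + suc (d ℕ.+ 0)
  [1+d]*p*1≡p*[1+d] rewrite ℕ.+-identityʳ d = trans (ℤ.*-identityʳ (+ suc d * p)) (ℤ.*-comm (+ suc d) p)

↥^k≡t*↧⇒↧≡1 : ∀ u k t → ↥ u ^ k ≡ t * ↧ u → ↧ u ≡ 1ℤ
↥^k≡t*↧⇒↧≡1 (mkℚ p d p⊥1+d) k t eq =
  cong +_ (coprime∧∣^⇒≡1 k (Coprime.recompute p⊥1+d) (divides ∣ t ∣ ∣p∣^k≡∣t∣*[1+d]))
  where
  ∣p∣^k≡∣t∣*[1+d] : ∣ p ∣ ℕ.^ k ≡ ∣ t ∣ ℕ.* suc d
  ∣p∣^k≡∣t∣*[1+d] = trans (sym (abs-^ p k)) (trans (cong ∣_∣ eq) (ℤ.abs-* t (+ suc d)))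

p*q≡0⇒p≡0∨q≡0 : ∀ p q → p ℚ.* q ≡ 0ℚ → p ≡ 0ℚ ⊎ q ≡ 0ℚ
p*q≡0⇒p≡0∨q≡0 p q pq≡0 = map (↥p≡0⇒p≡0 p) (↥p≡0⇒p≡0 q) (ℤ.i*j≡0⇒i≡0∨j≡0 (↥ p) ↥p*↥q≡0)
  where
  ↥p*↥q≡0 : ↥ p * ↥ q ≡ 0ℤ
  ↥p*↥q≡0 with ↥ (p ℚ.* q) | p≡0⇒↥p≡0 (p ℚ.* q) pq≡0 | ↥-* p q
  ... | _ | refl | ↥p*↥q≡0*nf = sym ↥p*↥q≡0*nf

p*p≡0⇒p≡0 : ∀ p → p ℚ.* p ≡ 0ℚ → p ≡ 0ℚ
p*p≡0⇒p≡0 p pp≡0 = [ id , id ]′ (p*q≡0⇒p≡0∨q≡0 p p pp≡0)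

p*p*p≡0⇒p≡0 : ∀ p → p ℚ.* p ℚ.* p ≡ 0ℚ → p ≡ 0ℚ
p*p*p≡0⇒p≡0 p ppp≡0 = [ p*p≡0⇒p≡0 p , id ]′ (p*q≡0⇒p≡0∨q≡0 (p ℚ.* p) p ppp≡0)

A : ℚ → ℚ → ℚ
A M X = X ℚ.* X ℚ.+ ι (+ 9) ℚ.* X ℚ.- ι (+ 3) ℚ.* M

C : ℚ → ℚ → ℚ
C M X = X ℚ.* X ℚ.* X ℚ.+ ι (+ 9) ℚ.* M ℚ.* X ℚ.+ ι (+ 27) ℚ.* M

-- The numerators q² A m (p / q) and q³ C m (p / q).
Aᶻ : ℤ → ℤ → ℤ → ℤ
Aᶻ m p q = p * p + + 9 * p * q - + 3 * m * (q * q)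

Cᶻ : ℤ → ℤ → ℤ → ℤ
Cᶻ m p q = p * p * p + + 9 * m * p * (q * q) + + 27 * m * (q * q * q)

A-expr B-expr C-expr : ∀ {k} → Polynomial k → Polynomial k → Polynomial k
A-expr M X = X :* X :+ con (ι (+ 9)) :* X :- con (ι (+ 3)) :* M
B-expr M X = X :* X :* X :- con (ι (+ 2)) :* M :* X :* X :- con (ι (+ 9)) :* M :* X
             :- con (ι (+ 2)) :* M :* M :- con (ι (+ 27)) :* M
C-expr M X = X :* X :* X :+ con (ι (+ 9)) :* M :* X :+ con (ι (+ 27)) :* M

R-at-0 : ∀ m X → R m 0ℚ X ≡ ι m ℚ.* (A (ι m) X ℚ.* A (ι m) X ℚ.* A (ι m) X)
R-at-0 m = solve 2 (λ M X → M :* (A-expr M X :* A-expr M X :* A-expr M X) :- con 0ℚ :* (B-expr M X :* B-expr M X)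
                            := M :* (A-expr M X :* A-expr M X :* A-expr M X)) refl (ι m)

R-at--27/4 : ∀ m X → ι (+ 4) ℚ.* R m (-[1+ 26 ] ℚ./ 4) X ≡ (ι (+ 4) ℚ.* ι m ℚ.+ ι (+ 27)) ℚ.* (C (ι m) X ℚ.* C (ι m) X)
R-at--27/4 m = solve 2 (λ M X → con (ι (+ 4)) :* (M :* (A-expr M X :* A-expr M X :* A-expr M X)
                                                  :- con (-[1+ 26 ] ℚ./ 4) :* (B-expr M X :* B-expr M X))
                                := (con (ι (+ 4)) :* M :+ con (ι (+ 27))) :* (C-expr M X :* C-expr M X)) refl (ι m)

A-clear-denominator : ∀ m p q u → ι q ℚ.* u ≡ ι p → ι q ℚ.* ι q ℚ.* A (ι m) u ≡ ι (Aᶻ m p q)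
A-clear-denominator m p q u qu≡p = begin
  Q ℚ.* Q ℚ.* A M u                                                                   ≡⟨ homogenise M u Q ⟩
  (Q ℚ.* u) ℚ.* (Q ℚ.* u) ℚ.+ ι (+ 9) ℚ.* (Q ℚ.* u) ℚ.* Q ℚ.- ι (+ 3) ℚ.* M ℚ.* (Q ℚ.* Q)
    ≡⟨ cong (λ P → P ℚ.* P ℚ.+ ι (+ 9) ℚ.* P ℚ.* Q ℚ.- ι (+ 3) ℚ.* M ℚ.* (Q ℚ.* Q)) qu≡p ⟩
  ι p ℚ.* ι p ℚ.+ ι (+ 9) ℚ.* ι p ℚ.* Q ℚ.- ι (+ 3) ℚ.* M ℚ.* (Q ℚ.* Q)              ≡⟨ ι-Aᶻ ⟨
  ι (Aᶻ m p q)                                                                        ∎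
  where
  open ≡-Reasoning
  M Q : ℚ
  M = ι m
  Q = ι q
  homogenise : ∀ M X Q → Q ℚ.* Q ℚ.* A M X
             ≡ (Q ℚ.* X) ℚ.* (Q ℚ.* X) ℚ.+ ι (+ 9) ℚ.* (Q ℚ.* X) ℚ.* Q ℚ.- ι (+ 3) ℚ.* M ℚ.* (Q ℚ.* Q)
  homogenise = solve 3 (λ M X Q → Q :* Q :* A-expr M X
                                  := (Q :* X) :* (Q :* X) :+ con (ι (+ 9)) :* (Q :* X) :* Q :- con (ι (+ 3)) :* M :* (Q :* Q)) refl
  ι-Aᶻ : ι (Aᶻ m p q) ≡ ι p ℚ.* ι p ℚ.+ ι (+ 9) ℚ.* ι p ℚ.* Q ℚ.- ι (+ 3) ℚ.* M ℚ.* (Q ℚ.* Q)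
  ι-Aᶻ = trans (ι-- (p * p + + 9 * p * q) (+ 3 * m * (q * q)))
    (cong₂ ℚ._-_ (trans (ι-+ (p * p) (+ 9 * p * q)) (cong₂ ℚ._+_ (ι-* p p) (ι-*-* (+ 9) p q)))
                 (trans (ι-* (+ 3 * m) (q * q)) (cong₂ ℚ._*_ (ι-* (+ 3) m) (ι-* q q))))

C-clear-denominator : ∀ m p q u → ι q ℚ.* u ≡ ι p → ι q ℚ.* ι q ℚ.* ι q ℚ.* C (ι m) u ≡ ι (Cᶻ m p q)
C-clear-denominator m p q u qu≡p = begin
  Q ℚ.* Q ℚ.* Q ℚ.* C M u                                                                  ≡⟨ homogenise M u Q ⟩
  (Q ℚ.* u) ℚ.* (Q ℚ.* u) ℚ.* (Q ℚ.* u) ℚ.+ ι (+ 9) ℚ.* M ℚ.* (Q ℚ.* u) ℚ.* (Q ℚ.* Q) ℚ.+ ι (+ 27) ℚ.* M ℚ.* (Q ℚ.* Q ℚ.* Q)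
    ≡⟨ cong (λ P → P ℚ.* P ℚ.* P ℚ.+ ι (+ 9) ℚ.* M ℚ.* P ℚ.* (Q ℚ.* Q) ℚ.+ ι (+ 27) ℚ.* M ℚ.* (Q ℚ.* Q ℚ.* Q)) qu≡p ⟩
  ι p ℚ.* ι p ℚ.* ι p ℚ.+ ι (+ 9) ℚ.* M ℚ.* ι p ℚ.* (Q ℚ.* Q) ℚ.+ ι (+ 27) ℚ.* M ℚ.* (Q ℚ.* Q ℚ.* Q) ≡⟨ ι-Cᶻ ⟨
  ι (Cᶻ m p q)                                                                             ∎
  where
  open ≡-Reasoning
  M Q : ℚ
  M = ι m
  Q = ι q
  homogenise : ∀ M X Q → Q ℚ.* Q ℚ.* Q ℚ.* C M X
             ≡ (Q ℚ.* X) ℚ.* (Q ℚ.* X) ℚ.* (Q ℚ.* X) ℚ.+ ι (+ 9) ℚ.* M ℚ.* (Q ℚ.* X) ℚ.* (Q ℚ.* Q)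
               ℚ.+ ι (+ 27) ℚ.* M ℚ.* (Q ℚ.* Q ℚ.* Q)
  homogenise = solve 3 (λ M X Q → Q :* Q :* Q :* C-expr M X
                                  := (Q :* X) :* (Q :* X) :* (Q :* X) :+ con (ι (+ 9)) :* M :* (Q :* X) :* (Q :* Q)
                                     :+ con (ι (+ 27)) :* M :* (Q :* Q :* Q)) refl
  ι-Cᶻ : ι (Cᶻ m p q) ≡ ι p ℚ.* ι p ℚ.* ι p ℚ.+ ι (+ 9) ℚ.* M ℚ.* ι p ℚ.* (Q ℚ.* Q) ℚ.+ ι (+ 27) ℚ.* M ℚ.* (Q ℚ.* Q ℚ.* Q)
  ι-Cᶻ = trans (ι-+ (p * p * p + + 9 * m * p * (q * q)) (+ 27 * m * (q * q * q)))
    (cong₂ ℚ._+_ (trans (ι-+ (p * p * p) (+ 9 * m * p * (q * q)))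
                        (cong₂ ℚ._+_ (ι-*-* p p p) (trans (ι-* (+ 9 * m * p) (q * q)) (cong₂ ℚ._*_ (ι-*-* (+ 9) m p) (ι-* q q)))))
                 (trans (ι-* (+ 27 * m) (q * q * q)) (cong₂ ℚ._*_ (ι-* (+ 27) m) (ι-*-* q q q))))

A-root⇒Aᶻ-root : ∀ m u → A (ι m) u ≡ 0ℚ → Aᶻ m (↥ u) 1ℤ ≡ 0ℤ
A-root⇒Aᶻ-root m u A≡0 = subst (λ q → Aᶻ m (↥ u) q ≡ 0ℤ) ↧u≡1 Aᶻ≡0
  where
  open ≡-Reasoning
  Aᶻ≡0 : Aᶻ m (↥ u) (↧ u) ≡ 0ℤ
  Aᶻ≡0 = ι-injective (begin
    ι (Aᶻ m (↥ u) (↧ u))                    ≡⟨ A-clear-denominator m (↥ u) (↧ u) u (↧*≡↥ u) ⟨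
    ι (↧ u) ℚ.* ι (↧ u) ℚ.* A (ι m) u      ≡⟨ cong (ι (↧ u) ℚ.* ι (↧ u) ℚ.*_) A≡0 ⟩
    ι (↧ u) ℚ.* ι (↧ u) ℚ.* 0ℚ             ≡⟨ *-zeroʳ (ι (↧ u) ℚ.* ι (↧ u)) ⟩
    0ℚ                                      ∎)
  p²≡[3mq-9p]*q+Aᶻ : ∀ p q m → p * (p * 1ℤ) ≡ (+ 3 * m * q - + 9 * p) * q
                                                + 1ℤ * ((p * p + + 9 * p * q - + 3 * m * (q * q)) - 0ℤ)
  p²≡[3mq-9p]*q+Aᶻ = solve-∀
  ↧u≡1 : ↧ u ≡ 1ℤ
  ↧u≡1 = ↥^k≡t*↧⇒↧≡1 u 2 (+ 3 * m * ↧ u - + 9 * ↥ u)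
           (x≡y+c*[a-b]∧a≡b⇒x≡y 1ℤ (p²≡[3mq-9p]*q+Aᶻ (↥ u) (↧ u) m) Aᶻ≡0)

C-root⇒Cᶻ-root : ∀ m u → C (ι m) u ≡ 0ℚ → Cᶻ m (↥ u) 1ℤ ≡ 0ℤ
C-root⇒Cᶻ-root m u C≡0 = subst (λ q → Cᶻ m (↥ u) q ≡ 0ℤ) ↧u≡1 Cᶻ≡0
  where
  open ≡-Reasoning
  Q : ℚ
  Q = ι (↧ u)
  Cᶻ≡0 : Cᶻ m (↥ u) (↧ u) ≡ 0ℤ
  Cᶻ≡0 = ι-injective (begin
    ι (Cᶻ m (↥ u) (↧ u))           ≡⟨ C-clear-denominator m (↥ u) (↧ u) u (↧*≡↥ u) ⟨
    Q ℚ.* Q ℚ.* Q ℚ.* C (ι m) u   ≡⟨ cong (Q ℚ.* Q ℚ.* Q ℚ.*_) C≡0 ⟩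
    Q ℚ.* Q ℚ.* Q ℚ.* 0ℚ          ≡⟨ *-zeroʳ (Q ℚ.* Q ℚ.* Q) ⟩
    0ℚ                             ∎)
  p³≡[-9mpq-27mq²]*q+Cᶻ : ∀ p q m → p * (p * (p * 1ℤ)) ≡ (- (+ 9 * m * p * q) - + 27 * m * (q * q)) * q
                                          + 1ℤ * ((p * p * p + + 9 * m * p * (q * q) + + 27 * m * (q * q * q)) - 0ℤ)
  p³≡[-9mpq-27mq²]*q+Cᶻ = solve-∀
  ↧u≡1 : ↧ u ≡ 1ℤ
  ↧u≡1 = ↥^k≡t*↧⇒↧≡1 u 3 (- (+ 9 * m * ↥ u * ↧ u) - + 27 * m * (↧ u * ↧ u))
           (x≡y+c*[a-b]∧a≡b⇒x≡y 1ℤ (p³≡[-9mpq-27mq²]*q+Cᶻ (↥ u) (↧ u) m) Cᶻ≡0)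

Aᶻ-integral-root : ∀ m p → Aᶻ m p 1ℤ ≡ 0ℤ → ∃ λ c → m ≡ + 3 * c * (c + + 3)
Aᶻ-integral-root m p Aᶻ≡0
  with i^k≡t*p⇒p∣i p 2 (m - + 3 * p) prime[3] (x≡y+c*[a-b]∧a≡b⇒x≡y 1ℤ (p²≡[m-3p]*3+Aᶻ p m) Aᶻ≡0)
  where
  p²≡[m-3p]*3+Aᶻ : ∀ p m → p * (p * 1ℤ) ≡ (m - + 3 * p) * + 3
                                          + 1ℤ * ((p * p + + 9 * p * 1ℤ - + 3 * m * (1ℤ * 1ℤ)) - 0ℤ)
  p²≡[m-3p]*3+Aᶻ = solve-∀
... | ℤ∣.divides c refl = c , ℤ.*-cancelˡ-≡ (+ 3) m _ (x≡y+c*[a-b]∧a≡b⇒x≡y -1ℤ (3m≡3*3c[c+3]-Aᶻ c m) Aᶻ≡0)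
  where
  3m≡3*3c[c+3]-Aᶻ : ∀ c m → + 3 * m ≡ + 3 * (+ 3 * c * (c + + 3))
                               + -1ℤ * (((c * + 3) * (c * + 3) + + 9 * (c * + 3) * 1ℤ - + 3 * m * (1ℤ * 1ℤ)) - 0ℤ)
  3m≡3*3c[c+3]-Aᶻ = solve-∀

s*[s²-3s+3+m]≡1⇒m≡-8 : ∀ s m → m ≢ 0ℤ → s * (s * s - + 3 * s + + 3 + m) ≡ 1ℤ → m ≡ -[1+ 7 ]
s*[s²-3s+3+m]≡1⇒m≡-8 s m m≢0 eq with i*j≡1⇒i≡±1 s _ eq
... | inj₁ refl = contradiction (x≡y+c*[a-b]∧a≡b⇒x≡y 1ℤ (m≡[1+m]-1 m) eq) m≢0
  where
  m≡[1+m]-1 : ∀ m → m ≡ 0ℤ + 1ℤ * (1ℤ * (1ℤ * 1ℤ - + 3 * 1ℤ + + 3 + m) - 1ℤ)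
  m≡[1+m]-1 = solve-∀
... | inj₂ refl = x≡y+c*[a-b]∧a≡b⇒x≡y -1ℤ (m≡-8-[-7-m]-1 m) eq
  where
  m≡-8-[-7-m]-1 : ∀ m → m ≡ -[1+ 7 ] + -1ℤ * (-1ℤ * (-1ℤ * -1ℤ - + 3 * -1ℤ + + 3 + m) - 1ℤ)
  m≡-8-[-7-m]-1 = solve-∀

Cᶻ-integral-root : ∀ m p → m ≢ 0ℤ → Cᶻ m p 1ℤ ≡ 0ℤ → m ≡ -[1+ 7 ]
Cᶻ-integral-root m p m≢0 Cᶻ≡0
  with i^k≡t*p⇒p∣i p 3 (- (+ 3 * m * p) - + 9 * m) prime[3]
         (x≡y+c*[a-b]∧a≡b⇒x≡y 1ℤ (p³≡[-3mp-9m]*3+Cᶻ p m) Cᶻ≡0)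
  where
  p³≡[-3mp-9m]*3+Cᶻ : ∀ p m → p * (p * (p * 1ℤ)) ≡ (- (+ 3 * m * p) - + 9 * m) * + 3
                                       + 1ℤ * ((p * p * p + + 9 * m * p * (1ℤ * 1ℤ) + + 27 * m * (1ℤ * 1ℤ * 1ℤ)) - 0ℤ)
  p³≡[-3mp-9m]*3+Cᶻ = solve-∀
... | ℤ∣.divides y refl =
  s*[s²-3s+3+m]≡1⇒m≡-8 (y + 1ℤ) m m≢0
    (ℤ.*-cancelˡ-≡ (+ 27) _ 1ℤ (x≡y+c*[a-b]∧a≡b⇒x≡y 1ℤ (27s[s²-3s+3+m]≡27+Cᶻ y m) Cᶻ≡0))
  where
  27s[s²-3s+3+m]≡27+Cᶻ : ∀ y m → + 27 * ((y + 1ℤ) * ((y + 1ℤ) * (y + 1ℤ) - + 3 * (y + 1ℤ) + + 3 + m)) ≡ + 27 * 1ℤ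
       + 1ℤ * (((y * + 3) * (y * + 3) * (y * + 3) + + 9 * m * (y * + 3) * (1ℤ * 1ℤ) + + 27 * m * (1ℤ * 1ℤ * 1ℤ)) - 0ℤ)
  27s[s²-3s+3+m]≡27+Cᶻ = solve-∀

R-at-0-root⇒A-root : ∀ m u → m ≢ 0ℤ → R m 0ℚ u ≡ 0ℚ → A (ι m) u ≡ 0ℚ
R-at-0-root⇒A-root m u m≢0 R≡0 =
  [ (λ ιm≡0 → contradiction (ι-injective ιm≡0) m≢0) , p*p*p≡0⇒p≡0 (A (ι m) u) ]′
  (p*q≡0⇒p≡0∨q≡0 (ι m) _ (trans (sym (R-at-0 m u)) R≡0))

R-at--27/4-root⇒C-root : ∀ m u → R m (-[1+ 26 ] ℚ./ 4) u ≡ 0ℚ → C (ι m) u ≡ 0ℚ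
R-at--27/4-root⇒C-root m u R≡0 =
  [ (λ K≡0 → contradiction (ι-injective (trans ι[4m+27]≡K K≡0)) (4*m+27≢0 m)) , p*p≡0⇒p≡0 (C (ι m) u) ]′
  (p*q≡0⇒p≡0∨q≡0 K _ KC²≡0)
  where
  open ≡-Reasoning
  K : ℚ
  K = ι (+ 4) ℚ.* ι m ℚ.+ ι (+ 27)
  ι[4m+27]≡K : ι (+ 4 * m + + 27) ≡ K
  ι[4m+27]≡K = trans (ι-+ (+ 4 * m) (+ 27)) (cong (ℚ._+ ι (+ 27)) (ι-* (+ 4) m))
  KC²≡0 : K ℚ.* (C (ι m) u ℚ.* C (ι m) u) ≡ 0ℚ
  KC²≡0 = begin
    K ℚ.* (C (ι m) u ℚ.* C (ι m) u)  ≡⟨ R-at--27/4 m u ⟨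
    ι (+ 4) ℚ.* R m (-[1+ 26 ] ℚ./ 4) u ≡⟨ cong (ι (+ 4) ℚ.*_) R≡0 ⟩
    ι (+ 4) ℚ.* 0ℚ                     ≡⟨ *-zeroʳ (ι (+ 4)) ⟩
    0ℚ                                 ∎

R-at-0-root-3c : ∀ {m} c → m ≡ + 3 * c * (c + + 3) → R m 0ℚ (ι (+ 3 * c)) ≡ 0ℚ
R-at-0-root-3c {m} c refl = begin
  R m 0ℚ (ι p)                                             ≡⟨ R-at-0 m (ι p) ⟩
  ι m ℚ.* (A (ι m) (ι p) ℚ.* A (ι m) (ι p) ℚ.* A (ι m) (ι p)) ≡⟨ cong (λ a → ι m ℚ.* (a ℚ.* a ℚ.* a)) A≡0 ⟩
  ι m ℚ.* 0ℚ                                               ≡⟨ *-zeroʳ (ι m) ⟩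
  0ℚ                                                       ∎
  where
  open ≡-Reasoning
  p : ℤ
  p = + 3 * c
  Aᶻ≡0 : ∀ c → (+ 3 * c) * (+ 3 * c) + + 9 * (+ 3 * c) * 1ℤ - + 3 * (+ 3 * c * (c + + 3)) * (1ℤ * 1ℤ) ≡ 0ℤ
  Aᶻ≡0 = solve-∀
  A≡0 : A (ι m) (ι p) ≡ 0ℚ
  A≡0 = begin
    A (ι m) (ι p)                      ≡⟨ *-identityˡ (A (ι m) (ι p)) ⟨
    ι 1ℤ ℚ.* ι 1ℤ ℚ.* A (ι m) (ι p)   ≡⟨ A-clear-denominator m p 1ℤ (ι p) (*-identityˡ (ι p)) ⟩
    ι (Aᶻ m p 1ℤ)                     ≡⟨ cong ι (Aᶻ≡0 c) ⟩
    0ℚ                                 ∎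

R-at--27/4-root--6 : ∀ {m} → m ≡ -[1+ 7 ] → R m (-[1+ 26 ] ℚ./ 4) (ι -[1+ 5 ]) ≡ 0ℚ
R-at--27/4-root--6 refl = refl

lemma11 : ((m : ℤ) → m ≢ + 0 → (∃ λ (u : ℚ) → R m 0ℚ u ≡ 0ℚ) ⇔ (∃ λ (c : ℤ) → m ≡ + 3 * c * (c + + 3)))
    × ((m : ℤ) → m ≢ + 0 → (∃ λ (u : ℚ) → R m (-[1+ 26 ] ℚ./ 4) u ≡ 0ℚ) ⇔ (m ≡ -[1+ 7 ]))
lemma11 = (λ m m≢0 → mk⇔ (part-i⇒ m m≢0) part-i⇐) , (λ m m≢0 → mk⇔ (part-ii⇒ m m≢0) part-ii⇐)
  where
  part-i⇒ : ∀ m → m ≢ 0ℤ → (∃ λ u → R m 0ℚ u ≡ 0ℚ) → ∃ λ c → m ≡ + 3 * c * (c + + 3)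
  part-i⇒ m m≢0 (u , R≡0) = Aᶻ-integral-root m (↥ u) (A-root⇒Aᶻ-root m u (R-at-0-root⇒A-root m u m≢0 R≡0))
  part-i⇐ : ∀ {m} → (∃ λ c → m ≡ + 3 * c * (c + + 3)) → ∃ λ u → R m 0ℚ u ≡ 0ℚ
  part-i⇐ (c , m≡3c[c+3]) = ι (+ 3 * c) , R-at-0-root-3c c m≡3c[c+3]
  part-ii⇒ : ∀ m → m ≢ 0ℤ → (∃ λ u → R m (-[1+ 26 ] ℚ./ 4) u ≡ 0ℚ) → m ≡ -[1+ 7 ]
  part-ii⇒ m m≢0 (u , R≡0) = Cᶻ-integral-root m (↥ u) m≢0 (C-root⇒Cᶻ-root m u (R-at--27/4-root⇒C-root m u R≡0))
  part-ii⇐ : ∀ {m} → m ≡ -[1+ 7 ] → ∃ λ u → R m (-[1+ 26 ] ℚ./ 4) u ≡ 0ℚ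
  part-ii⇐ m≡-8 = ι -[1+ 5 ] , R-at--27/4-root--6 m≡-8
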